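{- Let $(G,c,\ell)$ be an instance of $k$-MHE, let $P'_1,\ldots,P'_s$ be a type partition of $V(G)$, and split every part containing both precolored and uncolored vertices into its precolored vertices and its uncolored vertices. Let $P_1,\ldots,P_t$ be the resulting parts consisting only of uncolored vertices. Then there is an extended full coloring of $c$ maximizing the number of happy edges under which each $P_i$, $1 \leq i \leq t$, is monochromatic (all its vertices receive the same color).
   Context: Let $G=(V,E)$ be a simple undirected graph and $k$ a positive integer. A partial $k$-coloring is a map $c : S \to [k]$ for some $S \subseteq V$ (precolored vertices; the others are uncolored); a full coloring $c' : V \to [k]$ is an extended full coloring of $c$ if $c'(v)=c(v)$ for all $v \in S$. An edge is happy if its endpoints have the same color. $k$-MHE: given $G$, $c$ and an integer $\ell$, decide whether some extended full coloring of $c$ makes at least $\ell$ edges happy. Two vertices $u,v$ have the same type if $N(u)\setminus\{v\} = N(v)\setminus\{u\}$. A type partition is a partition of $V(G)$ into sets such that all vertices in each set have the same type; the neighborhood diversity of $G$ is the minimum number of sets in a type partition. -}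

module Defs where

open import Data.Nat using (ℕ; _+_; _≤_)
open import Data.Fin using (Fin; _<?_) renaming (_≟_ to _≟ᶠ_)
open import Data.Fin.Properties using () 
open import Data.Bool using (Bool; true; false; _∧_; if_then_else_)
open import Data.Maybe using (Maybe; just; nothing)
open import Data.List using (List; concatMap; map; allFin)
open import Data.Nat.ListAction using (sum)
open import Data.Product using (_×_; _,_)
open import Relation.Binary.PropositionalEquality using (_≡_; _≢_)
open import Relation.Nullary.Decidable using (⌊_⌋)

record Graph (n : ℕ) : Set where
  field
    adj   : Fin n → Fin n → Bool
    sym   : ∀ u v → adj u v ≡ adj v u
    irrefl : ∀ v → adj v v ≡ false
open Graph public

PartialColoring : ℕ → ℕ → Set
PartialColoring n k = Fin n → Maybe (Fin k)

FullColoring : ℕ → ℕ → Set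
FullColoring n k = Fin n → Fin k

Extends : ∀ {n k} → FullColoring n k → PartialColoring n k → Set
Extends c' c = ∀ v a → c v ≡ just a → c' v ≡ a

Uncolored : ∀ {n k} → PartialColoring n k → Fin n → Set
Uncolored c v = c v ≡ nothing

pairs : (n : ℕ) → List (Fin n × Fin n)
pairs n = concatMap (λ u → map (λ v → (u , v)) (allFin n)) (allFin n)

-- Number of happy edges: each edge {u,v} counted once (as u < v).
happyEdges : ∀ {n k} → Graph n → FullColoring n k → ℕ
happyEdges {n} G c' = sum (map f (pairs n))
  where
  f : Fin n × Fin n → ℕ
  f (u , v) = if ⌊ u <? v ⌋ ∧ adj G u v ∧ ⌊ c' u ≟ᶠ c' v ⌋ then 1 else 0

SameType : ∀ {n} → Graph n → Fin n → Fin n → Set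
SameType G u v = ∀ w → w ≢ u → w ≢ v → adj G u w ≡ adj G v w

IsTypePartition : ∀ {n s} → Graph n → (Fin n → Fin s) → Set
IsTypePartition G p = ∀ u v → p u ≡ p v → SameType G u v

-- Start from an optimal extension and make the uncoloured vertices of each part agree one
-- vertex at a time, recolouring an uncoloured v to the colour of an already treated uncoloured
-- vertex u of its part. Recolouring v from d v to y changes the number of happy edges by the
-- number of neighbours of v coloured y minus the number coloured d v. As u and v have the same
-- neighbours apart from each other, optimality of d against recolouring u to d v says that v,
-- too, has at least as many neighbours of colour d u as of colour d v; so the recolouring of v
-- keeps d optimal.
module Submission where

open import Defs renaming (sym to adj-sym)
open import Data.Nat.Properties
  using (+-0-commutativeMonoid; +-assoc; +-identityʳ; ≤-trans; ≤-reflexive;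
         +-cancelˡ-≤; +-cancelʳ-≤; +-monoˡ-≤; +-monoʳ-≤; m≤m+n; module ≤-Reasoning)
open import Algebra.Properties.CommutativeMonoid.Sum +-0-commutativeMonoid
  using (sum-syntax; ∑-distrib-+; sum-cong-≗; sum-remove)
open import Data.Bool using (false; _∧_; if_then_else_)
open import Data.Bool.Properties using (∧-zeroʳ)
open import Data.Empty using (⊥-elim)
open import Data.Fin using (Fin; zero; suc; punchIn; _<_; _<?_) renaming (_≟_ to _≟ᶠ_)
open import Data.Fin.Properties using (<-cmp; <-irrefl; punchInᵢ≢i)
open import Data.List using (List; []; _∷_; _++_; map; allFin; tabulate; concatMap)
open import Data.List.Extrema.Nat using (argmax; f[xs]≤f[argmax])
open import Data.List.Membership.Propositional using (_∈_; find; lose)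
open import Data.List.Membership.Propositional.Properties using (∈-allFin)
open import Data.List.Properties using (map-++; map-tabulate; map-∘; map-cong)
import Data.List.Relation.Unary.All as All
open import Data.List.Relation.Unary.Any using (Any; here; there; any?)
open import Data.Maybe using (just; nothing; fromMaybe)
open import Data.Maybe.Properties using (≡-dec)
open import Data.Nat using (ℕ; zero; suc; _+_; _≤_)
import Data.Nat.ListAction as List
open import Data.Nat.ListAction.Properties using (sum-++)
open import Data.Nat.Tactic.RingSolver using (solve-∀)
open import Data.Product using (Σ; ∃; _×_; _,_; proj₁; proj₂)
open import Data.Vec.Functional using (updateAt; head; tail) renaming (_∷_ to _◂_)
open import Data.Vec.Functional.Properties using (updateAt-updates; updateAt-minimal; updateAt-id-local)
open import Function using (id; const; _∘_)
open import Function.Bundles using (mk⇔)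
open import Relation.Binary using (tri<; tri≈; tri>)
open import Relation.Binary.PropositionalEquality
  using (_≡_; _≢_; _≗_; refl; sym; trans; cong; cong₂; module ≡-Reasoning)
open import Relation.Nullary using (¬_; Dec; yes; no)
open import Relation.Nullary.Decidable using (⌊_⌋; does; isYes≗does; dec-false; does-⇔; _×-dec_)

+-swap-outer : ∀ a r b → a + r + b ≡ b + r + a
+-swap-outer = solve-∀

∑-agreeOff : ∀ {n} (v : Fin n) (f g : Fin n → ℕ) → (∀ w → w ≢ v → f w ≡ g w)
           → (∑[ w < n ] f w) + g v ≡ (∑[ w < n ] g w) + f v
∑-agreeOff {suc n} v f g f≡g = begin
  (∑[ w < suc n ] f w) + g v               ≡⟨ cong (_+ g v) (sum-remove {i = v} f) ⟩
  f v + (∑[ i < n ] f (punchIn v i)) + g v ≡⟨ cong (λ r → f v + r + g v) rest ⟩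
  f v + (∑[ i < n ] g (punchIn v i)) + g v ≡⟨ +-swap-outer (f v) _ (g v) ⟩
  g v + (∑[ i < n ] g (punchIn v i)) + f v ≡⟨ cong (_+ f v) (sym (sum-remove {i = v} g)) ⟩
  (∑[ w < suc n ] g w) + f v               ∎
  where
  open ≡-Reasoning
  rest : ∑[ i < n ] f (punchIn v i) ≡ ∑[ i < n ] g (punchIn v i)
  rest = sum-cong-≗ (λ i → f≡g (punchIn v i) (punchInᵢ≢i v i))

∑-agreeOff₂ : ∀ {n} {u v : Fin n} (f g : Fin n → ℕ) → u ≢ v
            → (∀ w → w ≢ u → w ≢ v → f w ≡ g w) → f u ≡ g v
            → (∑[ w < n ] f w) + g u ≡ (∑[ w < n ] g w) + f v
∑-agreeOff₂ {n} {u} {v} f g u≢v f≡g fu≡gv = begin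
  ∑f + g u ≡⟨ cong (∑f +_) (sym (updateAt-updates u f)) ⟩
  ∑f + h u ≡⟨ ∑-agreeOff u f h f≡h ⟩
  ∑h + f u ≡⟨ cong (∑h +_) fu≡gv ⟩
  ∑h + g v ≡⟨ ∑-agreeOff v h g h≡g ⟩
  ∑g + h v ≡⟨ cong (∑g +_) (updateAt-minimal v u f (λ v≡u → u≢v (sym v≡u))) ⟩
  ∑g + f v ∎
  where
  open ≡-Reasoning
  h : Fin n → ℕ
  h = updateAt f u (const (g u))
  ∑f = ∑[ w < n ] f w
  ∑g = ∑[ w < n ] g w
  ∑h = ∑[ w < n ] h w
  f≡h : ∀ w → w ≢ u → f w ≡ h w
  f≡h w w≢u = sym (updateAt-minimal w u f w≢u)
  h≡g : ∀ w → w ≢ v → h w ≡ g w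
  h≡g w w≢v with w ≟ᶠ u
  ... | yes refl = updateAt-updates u f
  ... | no w≢u   = trans (updateAt-minimal w u f w≢u) (f≡g w w≢u w≢v)

∑² : ∀ {n} → (Fin n → Fin n → ℕ) → ℕ
∑² {n} t = ∑[ a < n ] ∑[ b < n ] t a b

∑²-split : ∀ {n} (v : Fin (suc n)) (t : Fin (suc n) → Fin (suc n) → ℕ) → t v v ≡ 0
         → ∑² t ≡ (∑[ b < suc n ] (t v b + t b v)) + ∑[ i < n ] ∑[ j < n ] t (punchIn v i) (punchIn v j)
∑²-split {n} v t tvv≡0 = begin
  ∑² t
    ≡⟨ sum-remove {i = v} (λ a → ∑[ b < suc n ] t a b) ⟩
  row + (∑[ i < n ] ∑[ b < suc n ] t (punchIn v i) b)
    ≡⟨ cong (row +_) (sum-cong-≗ (λ i → sum-remove {i = v} (t (punchIn v i)))) ⟩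
  row + (∑[ i < n ] (t (punchIn v i) v + ∑[ j < n ] t (punchIn v i) (punchIn v j)))
    ≡⟨ cong (row +_) (∑-distrib-+ (λ i → t (punchIn v i) v) _) ⟩
  row + ((∑[ i < n ] t (punchIn v i) v) + rest)
    ≡⟨ cong (λ x → row + (x + rest)) (sym column) ⟩
  row + ((∑[ b < suc n ] t b v) + rest)
    ≡⟨ sym (+-assoc row _ rest) ⟩
  (row + ∑[ b < suc n ] t b v) + rest
    ≡⟨ cong (_+ rest) (sym (∑-distrib-+ (t v) (λ b → t b v))) ⟩
  (∑[ b < suc n ] (t v b + t b v)) + rest ∎
  where
  open ≡-Reasoning
  row = ∑[ b < suc n ] t v b
  rest = ∑[ i < n ] ∑[ j < n ] t (punchIn v i) (punchIn v j)
  column : ∑[ b < suc n ] t b v ≡ ∑[ i < n ] t (punchIn v i) v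
  column = trans (sum-remove {i = v} (λ b → t b v)) (cong (_+ (∑[ i < n ] t (punchIn v i) v)) tvv≡0)

∑²-local : ∀ {n} (v : Fin n) (t t′ : Fin n → Fin n → ℕ) → t v v ≡ 0 → t′ v v ≡ 0
         → (∀ a b → a ≢ v → b ≢ v → t a b ≡ t′ a b)
         → ∑² t + (∑[ b < n ] (t′ v b + t′ b v)) ≡ ∑² t′ + (∑[ b < n ] (t v b + t b v))
∑²-local {suc n} v t t′ tvv≡0 t′vv≡0 t≡t′ = begin
  ∑² t + through t′                    ≡⟨ cong (_+ through t′) (∑²-split v t tvv≡0) ⟩
  through t + avoiding t + through t′  ≡⟨ cong (λ r → through t + r + through t′) avoiding-≡ ⟩
  through t + avoiding t′ + through t′ ≡⟨ +-swap-outer (through t) _ (through t′) ⟩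
  through t′ + avoiding t′ + through t ≡⟨ cong (_+ through t) (sym (∑²-split v t′ t′vv≡0)) ⟩
  ∑² t′ + through t                    ∎
  where
  open ≡-Reasoning
  through avoiding : (Fin (suc n) → Fin (suc n) → ℕ) → ℕ
  through s = ∑[ b < suc n ] (s v b + s b v)
  avoiding s = ∑[ i < n ] ∑[ j < n ] s (punchIn v i) (punchIn v j)
  avoiding-≡ : avoiding t ≡ avoiding t′
  avoiding-≡ = sum-cong-≗ λ i → sum-cong-≗ λ j → t≡t′ _ _ (punchInᵢ≢i v i) (punchInᵢ≢i v j)

sum-tabulate : ∀ {n} (f : Fin n → ℕ) → List.sum (tabulate f) ≡ ∑[ i < n ] f i
sum-tabulate {zero}  f = refl
sum-tabulate {suc n} f = cong (f zero +_) (sum-tabulate (λ i → f (suc i)))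

sum-map-allFin : ∀ {n} (f : Fin n → ℕ) → List.sum (map f (allFin n)) ≡ ∑[ i < n ] f i
sum-map-allFin f = trans (cong List.sum (map-tabulate id f)) (sum-tabulate f)

sum-map-concatMap : ∀ {A B : Set} (f : B → ℕ) (g : A → List B) (xs : List A)
                  → List.sum (map f (concatMap g xs)) ≡ List.sum (map (λ x → List.sum (map f (g x))) xs)
sum-map-concatMap f g []       = refl
sum-map-concatMap f g (x ∷ xs) = begin
  List.sum (map f (g x ++ concatMap g xs))
    ≡⟨ cong List.sum (map-++ f (g x) (concatMap g xs)) ⟩
  List.sum (map f (g x) ++ map f (concatMap g xs))
    ≡⟨ sum-++ (map f (g x)) _ ⟩
  List.sum (map f (g x)) + List.sum (map f (concatMap g xs))
    ≡⟨ cong (List.sum (map f (g x)) +_) (sum-map-concatMap f g xs) ⟩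
  List.sum (map (λ x → List.sum (map f (g x))) (x ∷ xs)) ∎
  where open ≡-Reasoning

sum-map-pairs : ∀ {n} (f : Fin n × Fin n → ℕ) → List.sum (map f (pairs n)) ≡ ∑² (λ a b → f (a , b))
sum-map-pairs {n} f = begin
  List.sum (map f (pairs n))
    ≡⟨ sum-map-concatMap f _ (allFin n) ⟩
  List.sum (map (λ a → List.sum (map f (map (a ,_) (allFin n)))) (allFin n))
    ≡⟨ cong List.sum (map-cong (λ a → cong List.sum (sym (map-∘ (allFin n)))) (allFin n)) ⟩
  List.sum (map (λ a → List.sum (map (λ b → f (a , b)) (allFin n))) (allFin n))
    ≡⟨ cong List.sum (map-cong (λ a → sum-map-allFin (λ b → f (a , b))) (allFin n)) ⟩
  List.sum (map (λ a → ∑[ b < n ] f (a , b)) (allFin n))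
    ≡⟨ sum-map-allFin (λ a → ∑[ b < n ] f (a , b)) ⟩
  ∑² (λ a b → f (a , b)) ∎
  where open ≡-Reasoning

⌊⌋-false : ∀ {A : Set} (a? : Dec A) → ¬ A → ⌊ a? ⌋ ≡ false
⌊⌋-false a? ¬a = trans (isYes≗does a?) (dec-false a? ¬a)

⌊≟⌋-sym : ∀ {k} (x y : Fin k) → ⌊ x ≟ᶠ y ⌋ ≡ ⌊ y ≟ᶠ x ⌋
⌊≟⌋-sym x y = begin
  ⌊ x ≟ᶠ y ⌋     ≡⟨ isYes≗does (x ≟ᶠ y) ⟩
  does (x ≟ᶠ y)  ≡⟨ does-⇔ (mk⇔ sym sym) (x ≟ᶠ y) (y ≟ᶠ x) ⟩
  does (y ≟ᶠ x)  ≡⟨ sym (isYes≗does (y ≟ᶠ x)) ⟩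
  ⌊ y ≟ᶠ x ⌋     ∎
  where open ≡-Reasoning

∈-tail : ∀ {A : Set} {a v : A} {vs} → a ∈ v ∷ vs → a ≢ v → a ∈ vs
∈-tail (here a≡v) a≢v = ⊥-elim (a≢v a≡v)
∈-tail (there a∈) _   = a∈

recolour : ∀ {n k} → FullColoring n k → Fin n → Fin k → FullColoring n k
recolour d v y = updateAt d v (const y)

recolour-agreeOff : ∀ {n k} (d : FullColoring n k) v y w → w ≢ v → d w ≡ recolour d v y w
recolour-agreeOff d v y w w≢v = sym (updateAt-minimal w v d w≢v)

module _ {n k : ℕ} (G : Graph n) where

  happyPair : FullColoring n k → Fin n → Fin n → ℕ
  happyPair d a b = if ⌊ a <? b ⌋ ∧ adj G a b ∧ ⌊ d a ≟ᶠ d b ⌋ then 1 else 0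

  neighbourColour : FullColoring n k → Fin n → Fin k → Fin n → ℕ
  neighbourColour d v y w = if adj G v w ∧ ⌊ y ≟ᶠ d w ⌋ then 1 else 0

  colourDegree : FullColoring n k → Fin n → Fin k → ℕ
  colourDegree d v y = ∑[ w < n ] neighbourColour d v y w

  happyEdges≡∑² : ∀ d → happyEdges G d ≡ ∑² (happyPair d)
  happyEdges≡∑² d = sum-map-pairs {n} _

  happyPair-cong : ∀ {d d′} {a b} → d a ≡ d′ a → d b ≡ d′ b → happyPair d a b ≡ happyPair d′ a b
  happyPair-cong {a = a} {b} ea eb =
    cong₂ (λ x y → if ⌊ a <? b ⌋ ∧ adj G a b ∧ ⌊ x ≟ᶠ y ⌋ then 1 else 0) ea eb

  happyEdges-cong : ∀ {d d′} → d ≗ d′ → happyEdges G d ≡ happyEdges G d′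
  happyEdges-cong {d} {d′} d≗d′ = begin
    happyEdges G d        ≡⟨ happyEdges≡∑² d ⟩
    ∑² (happyPair d)      ≡⟨ sum-cong-≗ (λ a → sum-cong-≗ (λ b → happyPair-cong {d} {d′} (d≗d′ a) (d≗d′ b))) ⟩
    ∑² (happyPair d′)     ≡⟨ sym (happyEdges≡∑² d′) ⟩
    happyEdges G d′       ∎
    where open ≡-Reasoning

  happyPair-≮ : ∀ d {a b} → ¬ a < b → happyPair d a b ≡ 0
  happyPair-≮ d {a} {b} a≮b with a <? b
  ... | yes a<b = ⊥-elim (a≮b a<b)
  ... | no _    = refl

  happyPair-diag : ∀ d v → happyPair d v v ≡ 0
  happyPair-diag d v = happyPair-≮ d {v} {v} (<-irrefl refl)

  happyPair-< : ∀ d {a b} → a < b → happyPair d a b ≡ neighbourColour d a (d a) b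
  happyPair-< d {a} {b} a<b with a <? b
  ... | yes _   = refl
  ... | no a≮b  = ⊥-elim (a≮b a<b)

  neighbourColour-sym : ∀ d v w → neighbourColour d v (d v) w ≡ neighbourColour d w (d w) v
  neighbourColour-sym d v w =
    cong₂ (λ e c → if e ∧ c then 1 else 0) (adj-sym G v w) (⌊≟⌋-sym (d v) (d w))

  happyPair-through : ∀ d v w → happyPair d v w + happyPair d w v ≡ neighbourColour d v (d v) w
  happyPair-through d v w with <-cmp v w
  ... | tri< v<w _ w≮v = begin
    happyPair d v w + happyPair d w v     ≡⟨ cong₂ _+_ (happyPair-< d v<w) (happyPair-≮ d w≮v) ⟩
    neighbourColour d v (d v) w + 0       ≡⟨ +-identityʳ _ ⟩
    neighbourColour d v (d v) w           ∎
    where open ≡-Reasoning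
  ... | tri≈ _ refl _ rewrite happyPair-diag d v | irrefl G v = refl
  ... | tri> v≮w _ w<v = begin
    happyPair d v w + happyPair d w v     ≡⟨ cong₂ _+_ (happyPair-≮ d v≮w) (happyPair-< d w<v) ⟩
    neighbourColour d w (d w) v           ≡⟨ neighbourColour-sym d w v ⟩
    neighbourColour d v (d v) w           ∎
    where open ≡-Reasoning

  neighbourColour-self : ∀ d v y → neighbourColour d v y v ≡ 0
  neighbourColour-self d v y rewrite irrefl G v = refl

  neighbourColour-≢ : ∀ d v {y w} → y ≢ d w → neighbourColour d v y w ≡ 0
  neighbourColour-≢ d v {y} {w} y≢dw =
    cong (λ e → if e then 1 else 0)
         (trans (cong (adj G v w ∧_) (⌊⌋-false (y ≟ᶠ d w) y≢dw)) (∧-zeroʳ (adj G v w)))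

  colourDegree-local : ∀ {d d′} v y → (∀ w → w ≢ v → d w ≡ d′ w) → colourDegree d v y ≡ colourDegree d′ v y
  colourDegree-local {d} {d′} v y d≡d′ = sum-cong-≗ pointwise
    where
    pointwise : ∀ w → neighbourColour d v y w ≡ neighbourColour d′ v y w
    pointwise w with w ≟ᶠ v
    ... | yes refl = trans (neighbourColour-self d v y) (sym (neighbourColour-self d′ v y))
    ... | no w≢v   = cong (λ x → if adj G v w ∧ ⌊ y ≟ᶠ x ⌋ then 1 else 0) (d≡d′ w w≢v)

  happyEdges-recolour : ∀ d v y
    → happyEdges G d + colourDegree d v y ≡ happyEdges G (recolour d v y) + colourDegree d v (d v)
  happyEdges-recolour d v y = begin
    happyEdges G d + colourDegree d v y
      ≡⟨ cong₂ _+_ (happyEdges≡∑² d) through-d′ ⟩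
    ∑² (happyPair d) + (∑[ b < n ] (happyPair d′ v b + happyPair d′ b v))
      ≡⟨ ∑²-local v (happyPair d) (happyPair d′) (happyPair-diag d v) (happyPair-diag d′ v)
                  (λ a b a≢v b≢v → happyPair-cong {d} {d′} (d≡d′ a a≢v) (d≡d′ b b≢v)) ⟩
    ∑² (happyPair d′) + (∑[ b < n ] (happyPair d v b + happyPair d b v))
      ≡⟨ cong₂ _+_ (sym (happyEdges≡∑² d′)) (sum-cong-≗ (happyPair-through d v)) ⟩
    happyEdges G d′ + colourDegree d v (d v) ∎
    where
    open ≡-Reasoning
    d′ = recolour d v y
    d≡d′ : ∀ w → w ≢ v → d w ≡ d′ w
    d≡d′ = recolour-agreeOff d v y
    through-d′ : colourDegree d v y ≡ ∑[ b < n ] (happyPair d′ v b + happyPair d′ b v)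
    through-d′ = begin
      colourDegree d v y          ≡⟨ colourDegree-local v y d≡d′ ⟩
      colourDegree d′ v y         ≡⟨ cong (colourDegree d′ v) (sym (updateAt-updates v d)) ⟩
      colourDegree d′ v (d′ v)    ≡⟨ sym (sum-cong-≗ (happyPair-through d′ v)) ⟩
      ∑[ b < n ] (happyPair d′ v b + happyPair d′ b v) ∎

  colourDegree-twins : ∀ d {u v} y → u ≢ v → SameType G u v
    → colourDegree d u y + neighbourColour d v y u ≡ colourDegree d v y + neighbourColour d u y v
  colourDegree-twins d {u} {v} y u≢v twins =
    ∑-agreeOff₂ (neighbourColour d u y) (neighbourColour d v y) u≢v same-outside
      (trans (neighbourColour-self d u y) (sym (neighbourColour-self d v y)))
    where
    same-outside : ∀ w → w ≢ u → w ≢ v → neighbourColour d u y w ≡ neighbourColour d v y w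
    same-outside w w≢u w≢v = cong (λ e → if e ∧ ⌊ y ≟ᶠ d w ⌋ then 1 else 0) (twins w w≢u w≢v)

  colourDegree-twins-≤ : ∀ d {u v} → d u ≢ d v → SameType G u v
    → colourDegree d u (d v) ≤ colourDegree d u (d u) → colourDegree d v (d v) ≤ colourDegree d v (d u)
  colourDegree-twins-≤ d {u} {v} du≢dv twins u-prefers-du = begin
    deg v (d v)                              ≤⟨ m≤m+n _ _ ⟩
    deg v (d v) + neighbourColour d u (d v) v ≡⟨ sym (colourDegree-twins d (d v) u≢v twins) ⟩
    deg u (d v) + neighbourColour d v (d v) u ≡⟨ cong (deg u (d v) +_) (neighbourColour-≢ d v (λ dv≡du → du≢dv (sym dv≡du))) ⟩
    deg u (d v) + 0                          ≡⟨ +-identityʳ _ ⟩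
    deg u (d v)                              ≤⟨ u-prefers-du ⟩
    deg u (d u)                              ≤⟨ m≤m+n _ _ ⟩
    deg u (d u) + neighbourColour d v (d u) u ≡⟨ colourDegree-twins d (d u) u≢v twins ⟩
    deg v (d u) + neighbourColour d u (d u) v ≡⟨ cong (deg v (d u) +_) (neighbourColour-≢ d u du≢dv) ⟩
    deg v (d u) + 0                          ≡⟨ +-identityʳ _ ⟩
    deg v (d u)                              ∎
    where
    open ≤-Reasoning
    deg = colourDegree d
    u≢v : u ≢ v
    u≢v refl = du≢dv refl

  recolour-twin-≤ : ∀ d {u v} → SameType G u v
    → happyEdges G (recolour d u (d v)) ≤ happyEdges G d → happyEdges G d ≤ happyEdges G (recolour d v (d u))
  recolour-twin-≤ d {u} {v} twins u-optimal with d u ≟ᶠ d v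
  ... | yes du≡dv = ≤-reflexive (sym (happyEdges-cong (updateAt-id-local v d du≡dv)))
  ... | no du≢dv = +-cancelʳ-≤ (deg v (d v)) _ _ (begin
    happyEdges G d + deg v (d v)                     ≤⟨ +-monoʳ-≤ _ (colourDegree-twins-≤ d du≢dv twins u-prefers-du) ⟩
    happyEdges G d + deg v (d u)                     ≡⟨ happyEdges-recolour d v (d u) ⟩
    happyEdges G (recolour d v (d u)) + deg v (d v)  ∎)
    where
    open ≤-Reasoning
    deg = colourDegree d
    u-prefers-du : deg u (d v) ≤ deg u (d u)
    u-prefers-du = +-cancelˡ-≤ (happyEdges G d) _ _ (begin
      happyEdges G d + deg u (d v)                    ≡⟨ happyEdges-recolour d u (d v) ⟩
      happyEdges G (recolour d u (d v)) + deg u (d u) ≤⟨ +-monoˡ-≤ _ u-optimal ⟩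
      happyEdges G d + deg u (d u)                    ∎)

∃-maximiser : ∀ n {m} (Φ : (Fin n → Fin (suc m)) → ℕ) → (∀ {f g} → f ≗ g → Φ f ≡ Φ g)
            → ∃ λ f → ∀ g → Φ g ≤ Φ f
∃-maximiser zero    Φ Φ-cong = (λ ()) , λ g → ≤-reflexive (Φ-cong (λ ()))
∃-maximiser (suc n) {m} Φ Φ-cong = best a* , λ g → begin
    Φ g                    ≡⟨ Φ-cong (λ { zero → refl ; (suc i) → refl }) ⟩
    Φ (head g ◂ tail g)    ≤⟨ proj₂ (tail-maximiser (head g)) (tail g) ⟩
    Φ (best (head g))      ≤⟨ All.lookup (f[xs]≤f[argmax] {f = Φ ∘ best} zero (allFin _)) (∈-allFin (head g)) ⟩
    Φ (best a*)            ∎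
  where
  open ≤-Reasoning
  tail-maximiser : ∀ a → ∃ λ h → ∀ g → Φ (a ◂ g) ≤ Φ (a ◂ h)
  tail-maximiser a = ∃-maximiser n (λ h → Φ (a ◂ h)) (λ f≗g → Φ-cong λ { zero → refl ; (suc i) → f≗g i })
  best : Fin (suc m) → Fin (suc n) → Fin (suc m)
  best a = a ◂ proj₁ (tail-maximiser a)
  a* : Fin (suc m)
  a* = argmax (Φ ∘ best) zero (allFin _)

module _ {n m s : ℕ} (G : Graph n) (c : PartialColoring n (suc m)) (p : Fin n → Fin s) where

  OptimalExtension : FullColoring n (suc m) → Set
  OptimalExtension d = Extends d c × (∀ c″ → Extends c″ c → happyEdges G c″ ≤ happyEdges G d)

  MonochromaticOn : List (Fin n) → FullColoring n (suc m) → Set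
  MonochromaticOn vs d = ∀ {a b} → a ∈ vs → b ∈ vs → Uncolored c a → Uncolored c b → p a ≡ p b → d a ≡ d b

  extend : FullColoring n (suc m) → FullColoring n (suc m)
  extend g v = fromMaybe (g v) (c v)

  extend-extends : ∀ g → Extends (extend g) c
  extend-extends g v a cv≡a rewrite cv≡a = refl

  extend-id : ∀ {g} → Extends g c → extend g ≗ g
  extend-id {g} g-extends v with c v in cv
  ... | just a  = sym (g-extends v a cv)
  ... | nothing = refl

  ∃-optimalExtension : ∃ OptimalExtension
  ∃-optimalExtension = extend g* , extend-extends g* , λ c″ c″-extends → begin
    happyEdges G c″          ≡⟨ happyEdges-cong G (λ v → sym (extend-id c″-extends v)) ⟩
    happyEdges G (extend c″) ≤⟨ proj₂ maximiser c″ ⟩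
    happyEdges G (extend g*) ∎
    where
    open ≤-Reasoning
    maximiser = ∃-maximiser n (happyEdges G ∘ extend)
                  (λ {f} {g} f≗g → happyEdges-cong G λ v → cong (λ x → fromMaybe x (c v)) (f≗g v))
    g* = proj₁ maximiser

  uncoloured? : ∀ v → Dec (Uncolored c v)
  uncoloured? v = ≡-dec _≟ᶠ_ (c v) nothing

  recolour-extends : ∀ {d v} y → Extends d c → Uncolored c v → Extends (recolour d v y) c
  recolour-extends {d} {v} y d-extends cv≡nothing w a cw≡a with w ≟ᶠ v
  ... | yes refl with () ← trans (sym cv≡nothing) cw≡a
  ... | no w≢v = trans (updateAt-minimal w v d w≢v) (d-extends w a cw≡a)

  recolour-optimal : IsTypePartition G p → ∀ {d u v} → OptimalExtension d
    → Uncolored c u → Uncolored c v → p u ≡ p v → OptimalExtension (recolour d v (d u))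
  recolour-optimal type-partition {d} {u} {v} (d-extends , d-optimal) cu cv pu≡pv =
    recolour-extends (d u) d-extends cv ,
    λ c″ c″-extends → ≤-trans (d-optimal c″ c″-extends)
      (recolour-twin-≤ G d (type-partition u v pu≡pv) (d-optimal _ (recolour-extends (d v) d-extends cu)))

  PartnerIn : List (Fin n) → Fin n → Set
  PartnerIn vs v = Any (λ x → Uncolored c x × p x ≡ p v) vs

  monochromaticOn-∷-keep : ∀ {vs v d} → MonochromaticOn vs d → ¬ (Uncolored c v × PartnerIn vs v)
    → MonochromaticOn (v ∷ vs) d
  monochromaticOn-∷-keep mono lonely (here refl) (here refl) _  _  _   = refl
  monochromaticOn-∷-keep mono lonely (here refl) (there b∈) ca cb pab = ⊥-elim (lonely (ca , lose b∈ (cb , sym pab)))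
  monochromaticOn-∷-keep mono lonely (there a∈) (here refl) ca cb pab = ⊥-elim (lonely (cb , lose a∈ (ca , pab)))
  monochromaticOn-∷-keep mono lonely (there a∈) (there b∈) ca cb pab = mono a∈ b∈ ca cb pab

  monochromaticOn-∷-recolour : ∀ {vs v x d} → MonochromaticOn vs d → x ∈ vs → Uncolored c x → p x ≡ p v
    → MonochromaticOn (v ∷ vs) (recolour d v (d x))
  monochromaticOn-∷-recolour {vs} {v} {x} {d} mono x∈ cx px≡pv {a} {b} a∈ b∈ ca cb pa≡pb with p a ≟ᶠ p v
  ... | yes pa≡pv = trans (in-part a∈ ca pa≡pv) (sym (in-part b∈ cb (trans (sym pa≡pb) pa≡pv)))
    where
    in-part : ∀ {w} → w ∈ v ∷ vs → Uncolored c w → p w ≡ p v → recolour d v (d x) w ≡ d x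
    in-part {w} w∈ cw pw≡pv with w ≟ᶠ v
    ... | yes refl = updateAt-updates w d
    ... | no w≢v   = trans (updateAt-minimal w v d w≢v) (mono (∈-tail w∈ w≢v) x∈ cw cx (trans pw≡pv (sym px≡pv)))
  ... | no pa≢pv = begin
    recolour d v (d x) a ≡⟨ updateAt-minimal a v d a≢v ⟩
    d a                  ≡⟨ mono (∈-tail a∈ a≢v) (∈-tail b∈ b≢v) ca cb pa≡pb ⟩
    d b                  ≡⟨ sym (updateAt-minimal b v d b≢v) ⟩
    recolour d v (d x) b ∎
    where
    open ≡-Reasoning
    a≢v : a ≢ v
    a≢v refl = pa≢pv refl
    b≢v : b ≢ v
    b≢v refl = pa≢pv pa≡pb

  optimal-monochromaticOn : IsTypePartition G p → ∀ vs → ∃ λ d → OptimalExtension d × MonochromaticOn vs d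
  optimal-monochromaticOn type-partition [] = proj₁ ∃-optimalExtension , proj₂ ∃-optimalExtension , λ ()
  optimal-monochromaticOn type-partition (v ∷ vs) with optimal-monochromaticOn type-partition vs
  ... | d , optimal , mono with uncoloured? v ×-dec any? (λ x → uncoloured? x ×-dec (p x ≟ᶠ p v)) vs
  ...   | no lonely = d , optimal , monochromaticOn-∷-keep mono lonely
  ...   | yes (cv , partner) with find partner
  ...     | x , x∈ , cx , px≡pv =
    recolour d v (d x) , recolour-optimal type-partition optimal cx cv px≡pv , monochromaticOn-∷-recolour mono x∈ cx px≡pv

lemma3 : (n k s : ℕ) → 1 ≤ k → (G : Graph n) → (c : PartialColoring n k)
    → (p : Fin n → Fin s) → IsTypePartition G p
    → Σ (FullColoring n k) (λ c' → Extends c' c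
        × (∀ c'' → Extends c'' c → happyEdges G c'' ≤ happyEdges G c')
        × (∀ u v → Uncolored c u → Uncolored c v → p u ≡ p v → c' u ≡ c' v))
lemma3 n zero    s () G c p type-partition
lemma3 n (suc m) s _  G c p type-partition with optimal-monochromaticOn G c p type-partition (allFin n)
... | d , (d-extends , d-optimal) , mono =
  d , d-extends , d-optimal , λ u v cu cv pu≡pv → mono (∈-allFin u) (∈-allFin v) cu cv pu≡pv
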